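{- Let $G=(V,E)$ be a directed graph whose edges are given on the external tape of a RATM-BIO in an arbitrary order. Then the worst case external access trace complexity of the DFS-Random Access algorithm on the RATM-BIO is $O(|E|^2)$.
   Context: A RATM-BIO (random access Turing machine with blocking IO) with main memory size $M$ has four tapes: a main memory tape of $M$ cells with its address tape, and an unbounded external memory tape with its address tape; it has a main head with random access on the main memory tape and an external head that moves only one cell at a time on the external tape. Its transitions are partitioned into main memory computation transitions (the main head operates, the external head halts), external memory access transitions (the main head halts, the external head moves), and Read/Write transitions. On entering a Read (Write) state, the main head writes an external address on the external address tape and halts; the external head then moves cell by cell to the designated cell, whose content then replaces (is replaced by) the content of the main memory cell under the main head; then the external head halts and the main head resumes. The external access trace complexity is the total number of moves of the external head. Setting (semi-external): the main memory has size $O(|V|)$ and holds an array $free[\cdot]$ indexed by $V$ and a stack. The DFS-Random Access algorithm: set $free[u]=1$ for every vertex $u$; then for each vertex $u$: push $u$ on an empty stack; while the stack is nonempty, pop a vertex $v$; if $free[v]=1$, set $free[v]=0$ and, reading the edges out of $v$ from external memory one at a time (each edge being one read operation at its location on the external tape), push each out-neighbor $w$ of $v$ with $free[w]=1$ onto the stack. The only IO operations are these reads of edges. -}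

module Defs where

open import Data.Nat using (ℕ; zero; suc; _+_; _*_; ∣_-_∣)
open import Data.Bool using (Bool; true; false)
open import Data.Fin using (Fin; _≟_)
open import Data.List using (List; []; _∷_; length)
open import Data.List using (allFin)
open import Data.Product using (_×_; _,_; proj₁; proj₂)
open import Relation.Nullary using (does)
open import Relation.Binary.PropositionalEquality using (_≡_)

-- A directed graph G = (V, E) with V = Fin n.  The external tape holds
-- the edges, one per cell, cell i holding the i-th element of the list.
Edge : ℕ → Set
Edge n = Fin n × Fin n

Tape : ℕ → Set
Tape n = List (Edge n)

-- Main-memory state of the DFS-Random Access algorithm together with the
-- position of the external head and the accumulated external access trace
-- (total number of moves of the external head).
record State (n : ℕ) : Set where
  constructor mkState
  field
    free  : Fin n → Bool
    stack : List (Fin n)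
    head  : ℕ
    cost  : ℕ
open State public

initState : (n : ℕ) → State n
initState n = mkState (λ _ → true) [] 0 0

markUsed : {n : ℕ} → Fin n → (Fin n → Bool) → (Fin n → Bool)
markUsed v f w with does (w ≟ v)
... | true  = false
... | false = f w

-- One Read operation of the edge stored at external cell p:
-- the external head moves cell by cell from its position to p.
readCell : {n : ℕ} → ℕ → State n → State n
readCell p s = mkState (free s) (stack s) p (cost s + ∣ head s - p ∣)

pushIfFree : {n : ℕ} → Fin n → State n → State n
pushIfFree w s with free s w
... | true  = mkState (free s) (w ∷ stack s) (head s) (cost s)
... | false = s

-- Read, in tape order, every edge out of v (each edge read at its own
-- location on the external tape) and push its free heads.
-- 'p' is the index of the first cell of the remaining tape suffix.
scanOut : {n : ℕ} → Fin n → ℕ → Tape n → State n → State n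
scanOut v p []             s = s
scanOut v p ((x , w) ∷ es) s with does (x ≟ v)
... | true  = scanOut v (suc p) es (pushIfFree w (readCell p s))
... | false = scanOut v (suc p) es s

-- Big-step semantics of the inner "while stack nonempty" loop.
data Loop {n : ℕ} (tape : Tape n) : State n → State n → Set where
  done    : ∀ {f h c} → Loop tape (mkState f [] h c) (mkState f [] h c)
  popUsed : ∀ {f v st h c s'} → f v ≡ false →
            Loop tape (mkState f st h c) s' →
            Loop tape (mkState f (v ∷ st) h c) s'
  popFree : ∀ {f v st h c s'} → f v ≡ true →
            Loop tape (scanOut v 0 tape (mkState (markUsed v f) st h c)) s' →
            Loop tape (mkState f (v ∷ st) h c) s'

data Outer {n : ℕ} (tape : Tape n) : List (Fin n) → State n → State n → Set where
  []  : ∀ {s} → Outer tape [] s s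
  _∷_ : ∀ {u us f h c s₁ s₂} →
        Loop tape (mkState f (u ∷ []) h c) s₁ →
        Outer tape us s₁ s₂ →
        Outer tape (u ∷ us) (mkState f [] h c) s₂

DFSRun : {n : ℕ} → Tape n → State n → Set
DFSRun {n} tape final = Outer tape (allFin n) (initState n) final

-- Let L be the number of edges on the tape.  The external head never leaves
-- the cells 0 … L, so each read moves it at most L cells, and only the edges
-- out of a vertex v are read, once, when v is popped while still free.  Hence
-- cost + L · #(edges whose source is free) starts at L · L and never grows:
-- popping a free v adds at most L · outdeg(v) to the cost and removes outdeg(v)
-- edges from the count.  The run exists because each such pop decreases the
-- number of free vertices.
module Submission where

open import Defs
open import Data.Nat using (ℕ; _*_; _≤_)
open import Data.Fin using (Fin)
open import Data.List using (List; length)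
open import Data.List.Relation.Unary.Unique.Propositional using (Unique)
open import Data.Product using (_×_; ∃-syntax)

open import Data.Nat using (zero; suc; _+_; _<_; z≤n; s≤s)
open import Data.Nat.Properties hiding (_≟_)
open import Data.Bool using (Bool; true; false)
open import Data.Empty using (⊥-elim)
open import Data.Fin using (_≟_)
open import Data.List using ([]; _∷_; allFin)
open import Data.List.Membership.Propositional using (_∈_)
open import Data.List.Membership.Propositional.Properties using (∈-allFin)
open import Data.List.Relation.Unary.Any using (here; there)
open import Data.Product using (_,_; proj₁; proj₂)
open import Function using (_∘_)
import Algebra.Properties.CommutativeSemigroup as CommutativeSemigroupProperties
open import Relation.Nullary using (does; yes; no)
open import Relation.Binary.PropositionalEquality

toℕ : Bool → ℕ
toℕ true  = 1
toℕ false = 0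

count : {A : Set} → (A → Bool) → List A → ℕ
count p []       = 0
count p (x ∷ xs) = toℕ (p x) + count p xs

count-true : {A : Set} (xs : List A) → count (λ _ → true) xs ≡ length xs
count-true []       = refl
count-true (x ∷ xs) = cong suc (count-true xs)

toℕ-mono : ∀ {a b} → (a ≡ true → b ≡ true) → toℕ a ≤ toℕ b
toℕ-mono {false} _   = z≤n
toℕ-mono {true}  a⇒b rewrite a⇒b refl = ≤-refl

module _ {A : Set} (p q : A → Bool) (p⇒q : ∀ x → p x ≡ true → q x ≡ true) where

  count-mono : ∀ xs → count p xs ≤ count q xs
  count-mono []       = z≤n
  count-mono (x ∷ xs) = +-mono-≤ (toℕ-mono (p⇒q x)) (count-mono xs)

  count-mono-< : ∀ {v} xs → v ∈ xs → p v ≡ false → q v ≡ true → count p xs < count q xs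
  count-mono-< (x ∷ xs) (here refl) pv qv rewrite pv | qv = s≤s (count-mono xs)
  count-mono-< (x ∷ xs) (there v∈xs) pv qv =
    +-mono-≤-< (toℕ-mono (p⇒q x)) (count-mono-< xs v∈xs pv qv)

count-+ : {A : Set} (p q r : A → Bool) → (∀ x → toℕ (p x) ≡ toℕ (q x) + toℕ (r x)) →
          ∀ xs → count p xs ≡ count q xs + count r xs
count-+ p q r split []       = refl
count-+ p q r split (x ∷ xs) =
  trans (cong₂ _+_ (split x) (count-+ p q r split xs))
        (+-interchange (toℕ (q x)) (toℕ (r x)) (count q xs) (count r xs))
  where
  open CommutativeSemigroupProperties +-commutativeSemigroup
    renaming (interchange to +-interchange)

module _ {n : ℕ} where

  markUsed-⊆ : (v : Fin n) (f : Fin n → Bool) (w : Fin n) → markUsed v f w ≡ true → f w ≡ true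
  markUsed-⊆ v f w with w ≟ v
  ... | yes _ = λ ()
  ... | no  _ = λ fw → fw

  markUsed-self : (v : Fin n) (f : Fin n → Bool) → markUsed v f v ≡ false
  markUsed-self v f with v ≟ v
  ... | yes _  = refl
  ... | no v≢v = ⊥-elim (v≢v refl)

  freeVertices : (Fin n → Bool) → ℕ
  freeVertices f = count f (allFin n)

  freeVertices-markUsed : (v : Fin n) (f : Fin n → Bool) → f v ≡ true →
                          freeVertices (markUsed v f) < freeVertices f
  freeVertices-markUsed v f fv =
    count-mono-< (markUsed v f) f (markUsed-⊆ v f) (allFin n) (∈-allFin v) (markUsed-self v f) fv

  freeEdges : Tape n → (Fin n → Bool) → ℕ
  freeEdges tape f = count (f ∘ proj₁) tape

  outDegree : Tape n → Fin n → ℕ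
  outDegree tape v = count (λ e → does (proj₁ e ≟ v)) tape

  freeEdges-markUsed : (tape : Tape n) (v : Fin n) (f : Fin n → Bool) → f v ≡ true →
                       freeEdges tape f ≡ outDegree tape v + freeEdges tape (markUsed v f)
  freeEdges-markUsed tape v f fv = count-+ _ _ _ split tape
    where
    split : (e : Edge n) →
            toℕ (f (proj₁ e)) ≡ toℕ (does (proj₁ e ≟ v)) + toℕ (markUsed v f (proj₁ e))
    split (x , _) with x ≟ v
    ... | yes refl rewrite fv = refl
    ... | no  _    = refl

  pushIfFree-free : (w : Fin n) (s : State n) → free (pushIfFree w s) ≡ free s
  pushIfFree-free w s with free s w
  ... | true  = refl
  ... | false = refl

  pushIfFree-head : (w : Fin n) (s : State n) → head (pushIfFree w s) ≡ head s
  pushIfFree-head w s with free s w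
  ... | true  = refl
  ... | false = refl

  pushIfFree-cost : (w : Fin n) (s : State n) → cost (pushIfFree w s) ≡ cost s
  pushIfFree-cost w s with free s w
  ... | true  = refl
  ... | false = refl

  readCell-cost : (p : ℕ) (s : State n) {B : ℕ} → head s ≤ B → p ≤ B →
                  cost (readCell p s) ≤ cost s + B
  readCell-cost p s hs≤B p≤B =
    +-monoʳ-≤ (cost s) (≤-trans (∣m-n∣≤m⊔n (head s) p) (⊔-lub hs≤B p≤B))

  scanOut-free : (v : Fin n) (p : ℕ) (es : Tape n) (s : State n) → free (scanOut v p es s) ≡ free s
  scanOut-free v p []            s = refl
  scanOut-free v p ((x , w) ∷ es) s with does (x ≟ v)
  ... | true  = trans (scanOut-free v (suc p) es _) (pushIfFree-free w (readCell p s))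
  ... | false = scanOut-free v (suc p) es s

  scanOut-cost : (v : Fin n) (p : ℕ) (es : Tape n) (s : State n) {B : ℕ} →
                 head s ≤ B → p + length es ≤ B →
                 head (scanOut v p es s) ≤ B × cost (scanOut v p es s) ≤ cost s + B * outDegree es v
  scanOut-cost v p []            s hs≤B _ = hs≤B , m≤m+n (cost s) _
  scanOut-cost v p ((x , w) ∷ es) s {B} hs≤B end≤B with x ≟ v
  ... | no  _ = scanOut-cost v (suc p) es s hs≤B rest≤B
    where rest≤B = subst (_≤ B) (+-suc p (length es)) end≤B
  ... | yes _ = proj₁ IH , (begin
    cost (scanOut v (suc p) es s₁)     ≤⟨ proj₂ IH ⟩
    cost s₁ + B * outDegree es v       ≡⟨ cong (_+ B * outDegree es v) (pushIfFree-cost w (readCell p s)) ⟩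
    cost (readCell p s) + B * outDegree es v
                                       ≤⟨ +-monoˡ-≤ _ (readCell-cost p s hs≤B p≤B) ⟩
    (cost s + B) + B * outDegree es v  ≡⟨ +-assoc (cost s) B _ ⟩
    cost s + (B + B * outDegree es v)  ≡⟨ cong (cost s +_) (sym (*-suc B (outDegree es v))) ⟩
    cost s + B * suc (outDegree es v)  ∎)
    where
    open ≤-Reasoning
    s₁ = pushIfFree w (readCell p s)
    p≤B = ≤-trans (m≤m+n p (suc (length es))) end≤B
    IH = scanOut-cost v (suc p) es s₁
           (subst (_≤ B) (sym (pushIfFree-head w (readCell p s))) p≤B)
           (subst (_≤ B) (+-suc p (length es)) end≤B)

  Loop-empties-stack : {tape : Tape n} {s s' : State n} → Loop tape s s' → stack s' ≡ []
  Loop-empties-stack done            = refl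
  Loop-empties-stack (popUsed _ run) = Loop-empties-stack run
  Loop-empties-stack (popFree _ run) = Loop-empties-stack run

  -- The fuel k bounds the number of free pops still to come.
  Loop-exists : (tape : Tape n) (k : ℕ) (f : Fin n → Bool) (st : List (Fin n)) (h c : ℕ) →
                freeVertices f < k → ∃[ s' ] Loop tape (mkState f st h c) s'
  Loop-exists tape k f []       h c _ = _ , done
  Loop-exists tape k f (v ∷ st) h c fuel with f v in fv
  ... | false = let (s' , run) = Loop-exists tape k f st h c fuel in s' , popUsed fv run
  Loop-exists tape (suc k) f (v ∷ st) h c (s≤s fuel) | true =
    let S = scanOut v 0 tape (mkState (markUsed v f) st h c)
        fuel' = subst (λ g → freeVertices g < k) (sym (scanOut-free v 0 tape _))
                      (≤-trans (freeVertices-markUsed v f fv) fuel)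
        (s' , run) = Loop-exists tape k (free S) (stack S) (head S) (cost S) fuel'
    in s' , popFree fv run

  Outer-exists : (tape : Tape n) (us : List (Fin n)) (s : State n) → stack s ≡ [] →
                 ∃[ s' ] Outer tape us s s'
  Outer-exists tape []       s                  _    = s , []
  Outer-exists tape (u ∷ us) (mkState f .[] h c) refl =
    let (s₁ , loop) = Loop-exists tape (suc (freeVertices f)) f (u ∷ []) h c ≤-refl
        (s₂ , outer) = Outer-exists tape us s₁ (Loop-empties-stack loop)
    in s₂ , loop ∷ outer

  Invariant : Tape n → State n → Set
  Invariant tape s = head s ≤ length tape
                   × cost s + length tape * freeEdges tape (free s) ≤ length tape * length tape

  Loop-preserves : (tape : Tape n) {s s' : State n} → Loop tape s s' → Invariant tape s → Invariant tape s'
  Loop-preserves tape done              inv = inv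
  Loop-preserves tape (popUsed _ run)   inv = Loop-preserves tape run inv
  Loop-preserves tape (popFree {f} {v} {st} {h} {c} fv run) (h≤L , bound) =
    Loop-preserves tape run (proj₁ scan , bound')
    where
    L = length tape
    s₀ = mkState (markUsed v f) st h c
    S = scanOut v 0 tape s₀
    scan = scanOut-cost v 0 tape s₀ h≤L ≤-refl
    open ≤-Reasoning
    bound' : cost S + L * freeEdges tape (free S) ≤ L * L
    bound' = begin
      cost S + L * freeEdges tape (free S)
        ≡⟨ cong (λ g → cost S + L * freeEdges tape g) (scanOut-free v 0 tape s₀) ⟩
      cost S + L * freeEdges tape (markUsed v f)
        ≤⟨ +-monoˡ-≤ _ (proj₂ scan) ⟩
      (c + L * outDegree tape v) + L * freeEdges tape (markUsed v f)
        ≡⟨ +-assoc c _ _ ⟩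
      c + (L * outDegree tape v + L * freeEdges tape (markUsed v f))
        ≡⟨ cong (c +_) (sym (*-distribˡ-+ L (outDegree tape v) _)) ⟩
      c + L * (outDegree tape v + freeEdges tape (markUsed v f))
        ≡⟨ cong (λ m → c + L * m) (sym (freeEdges-markUsed tape v f fv)) ⟩
      c + L * freeEdges tape f
        ≤⟨ bound ⟩
      L * L ∎

  Outer-preserves : (tape : Tape n) {us : List (Fin n)} {s s' : State n} →
                    Outer tape us s s' → Invariant tape s → Invariant tape s'
  Outer-preserves tape []             inv = inv
  Outer-preserves tape (loop ∷ outer) inv = Outer-preserves tape outer (Loop-preserves tape loop inv)

  Invariant-init : (tape : Tape n) → Invariant tape (initState n)
  Invariant-init tape = z≤n , ≤-reflexive (cong (length tape *_) (count-true tape))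

  DFSRun-cost : (tape : Tape n) {final : State n} → DFSRun tape final →
                cost final ≤ length tape * length tape
  DFSRun-cost tape {final} run =
    ≤-trans (m≤m+n (cost final) _) (proj₂ (Outer-preserves tape run (Invariant-init tape)))

theorem8 : ∃[ c ] ∃[ N ] ((n : ℕ) (tape : Tape n) → Unique tape → N ≤ length tape →
             (∃[ final ] DFSRun tape final)
             × ((final : State n) → DFSRun tape final →
                  cost final ≤ c * (length tape * length tape)))
theorem8 = 1 , 0 , λ n tape _ _ →
  Outer-exists tape (allFin n) (initState n) refl ,
  λ final run → subst (cost final ≤_) (sym (*-identityˡ _)) (DFSRun-cost tape run)
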